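{- Let $I$ be a Boolean edge CSP instance whose constraint relations are even $\Delta$-matroids and let $f$ be a valid edge labeling of $I$. (a) If $T$ is an $f$-DAG consisting of two directed paths $x_0C_1^{t_1}x_1\dots x_{k-1}C_k^{t_k}$ and $y_0D_1^{s_1}\dots y_{\ell-1}D_\ell^{s_\ell}$ that are disjoint except at the common last node $C_k^{t_k}=D_\ell^{s_\ell}$, then $f\oplus T$ is a valid edge labeling of $I$. (b) If $T$ is an $f$-DAG consisting of a single directed path $x_0C_1^{t_1}x_1\dots x_{k-1}C_k^{t_k}x_k$, then $f\oplus T$ is a valid edge labeling of $I$.
   Context: For a tuple $\alpha$, $\alpha\oplus v$ flips coordinate $v$. A nonempty $M\subseteq\{0,1\}^V$ is a $\Delta$-matroid if for all $\alpha,\beta\in M$ and $v$ with $\alpha(v)\ne\beta(v)$ there is $u$ with $\alpha(u)\ne\beta(u)$ and $\alpha\oplus v\oplus u\in M$ (meaning $\alpha\oplus v\in M$ if $u=v$); even if all tuples have the same parity of number of ones. A Boolean edge CSP instance $I=(V,\mathcal C)$: finite variable set $V$, finite constraint set $\mathcal C$, each $C$ with nonempty scope $\sigma_C\subseteq V$ and relation $C\subseteq\{0,1\}^{\sigma_C}$; each variable in the scopes of exactly two distinct constraints. $\mathcal E=\{\{v,C\}:v\in\sigma_C\}$. An edge labeling is $f:\mathcal E\to\{0,1\}$ with $f(C)(v)=f(\{v,C\})$; valid if $f(C)\in C$ for all $C$. An $f$-DAG is a directed graph $T$ with node set $V(T)\cup\mathcal C(T)$, $V(T)\subseteq V$, $\mathcal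 C(T)\subseteq\mathcal C\times\mathbb N$ (the node $(C,t)$ written $C^t$, $t$ its timestamp), satisfying: (1) every edge has the form $vC^t$ or $C^tv$ with $\{v,C\}\in\mathcal E$; (2) for each $\{v,C\}\in\mathcal E$ there is at most one $t$ with $vC^t$ or $C^tv$ in $E(T)$, and $vC^t$, $C^tv$ are never both present; (3) each $v\in V(T)$ has at most one incoming edge; (4) timestamps of nodes in $\mathcal C(T)$ are pairwise distinct, and their order extends to a total order $\prec$ on $V(T)\cup\mathcal C(T)$ with $\alpha\prec\beta$ for every edge $\alpha\beta$; (5) if $T$ contains $uC^t$ and one of $vC^t$, $C^tv$, then $f(C)\oplus u\oplus v\in C$; (6) (no shortcuts) if $T$ contains $uC^s$ and one of $vC^t$, $C^tv$ with $s<t$, then $f(C)\oplus u\oplus v\notin C$. For an $f$-DAG $T$, $f\oplus T$ is the edge labeling obtained from $f$ by flipping $f(\{v,C\})$ for every $\{v,C\}$ such that $vC^t\in E(T)$ or $C^tv\in E(T)$ for some $t$. -}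

module Defs where

open import Data.Nat using (ℕ; zero; suc; _<_; _%_; _+_)
open import Data.Bool using (Bool; true; false; not; _∧_; _∨_; _xor_; if_then_else_)
open import Data.Fin using (Fin)
open import Data.Fin.Subset using (Subset; _∈_; Nonempty)
open import Data.Vec using (Vec; []; _∷_; lookup; tabulate; _[_]%=_)
open import Data.List using (List; []; _∷_; _++_; [_])
open import Data.List.Membership.Propositional using () renaming (_∈_ to _∈ₗ_)
open import Data.Product using (Σ; ∃; ∃₂; _×_; _,_)
open import Data.Sum using (_⊎_)
open import Relation.Nullary using (¬_)
open import Relation.Nullary.Decidable using (⌊_⌋; yes; no)
open import Relation.Binary.PropositionalEquality using (_≡_; _≢_)
import Data.Fin as Fin
import Data.Nat as Nat

-- Tuples.  Variables are Fin n.  A tuple in {0,1}^σ (σ ⊆ Fin n) is encoded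
-- as a vector in Vec Bool n that is 'false' outside σ (see Instance.rel-supp).

_⊕_ : ∀ {n} → Vec Bool n → Fin n → Vec Bool n
α ⊕ v = α [ v ]%= not

infixl 6 _⊕_

-- α ⊕ v ⊕ u, with the Δ-matroid convention that it means α ⊕ v when u = v
flipΔ : ∀ {n} → Vec Bool n → Fin n → Fin n → Vec Bool n
flipΔ α v u with v Fin.≟ u
... | yes _ = α ⊕ v
... | no  _ = α ⊕ v ⊕ u

ones : ∀ {n} → Vec Bool n → ℕ
ones [] = 0
ones (true  ∷ α) = suc (ones α)
ones (false ∷ α) = ones α

IsDeltaMatroid : ∀ {n} → Subset n → (Vec Bool n → Set) → Set
IsDeltaMatroid {n} σ M =
  (∃ λ α → M α) ×
  (∀ α β → M α → M β → ∀ v → v ∈ σ → lookup α v ≢ lookup β v →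
     ∃ λ u → u ∈ σ × lookup α u ≢ lookup β u × M (flipΔ α v u))

IsEven : ∀ {n} → (Vec Bool n → Set) → Set
IsEven M = ∀ α β → M α → M β → ones α % 2 ≡ ones β % 2

IsEvenDeltaMatroid : ∀ {n} → Subset n → (Vec Bool n → Set) → Set
IsEvenDeltaMatroid σ M = IsDeltaMatroid σ M × IsEven M

record Instance (n m : ℕ) : Set₁ where
  field
    scope     : Fin m → Subset n
    rel       : Fin m → Vec Bool n → Set
    rel-supp  : ∀ C α → rel C α → ∀ v → lookup (scope C) v ≡ false → lookup α v ≡ false
    scope-nonempty : ∀ C → Nonempty (scope C)
    two-scopes : ∀ v → ∃₂ λ C D → C ≢ D × v ∈ scope C × v ∈ scope D ×
                   (∀ E → v ∈ scope E → E ≡ C ⊎ E ≡ D)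

open Instance public

-- Edge labelings: f v C is the label of {v,C}; values with v ∉ σ_C are ignored.
Labeling : ℕ → ℕ → Set
Labeling n m = Fin n → Fin m → Bool

restrict : ∀ {n m} → Instance n m → Labeling n m → Fin m → Vec Bool n
restrict I f C = tabulate λ v → lookup (scope I C) v ∧ f v C

Valid : ∀ {n m} → Instance n m → Labeling n m → Set
Valid I f = ∀ C → rel I C (restrict I f C)

data Node (n m : ℕ) : Set where
  var : Fin n → Node n m
  con : Fin m → ℕ → Node n m

data Edge (n m : ℕ) : Set where
  vc : Fin n → Fin m → ℕ → Edge n m
  cv : Fin m → ℕ → Fin n → Edge n m

src tgt : ∀ {n m} → Edge n m → Node n m
src (vc v C t) = var v
src (cv C t v) = con C t
tgt (vc v C t) = con C t
tgt (cv C t v) = var v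

record DAG (n m : ℕ) : Set where
  constructor dag
  field
    nodes : List (Node n m)
    edges : List (Edge n m)

open DAG public

TouchesAt : ∀ {n m} → DAG n m → Fin n → Fin m → ℕ → Set
TouchesAt T v C t = vc v C t ∈ₗ edges T ⊎ cv C t v ∈ₗ edges T

record IsFDAG {n m} (I : Instance n m) (f : Labeling n m) (T : DAG n m) : Set where
  field
    edge-ends : ∀ e → e ∈ₗ edges T → src e ∈ₗ nodes T × tgt e ∈ₗ nodes T
    -- (1)
    edge-vc : ∀ v C t → vc v C t ∈ₗ edges T → v ∈ scope I C
    edge-cv : ∀ v C t → cv C t v ∈ₗ edges T → v ∈ scope I C
    -- (2)
    one-time : ∀ v C t t' → TouchesAt T v C t → TouchesAt T v C t' → t ≡ t'
    not-both : ∀ v C t → vc v C t ∈ₗ edges T → ¬ (cv C t v ∈ₗ edges T)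
    -- (3)
    one-incoming : ∀ v e e' → e ∈ₗ edges T → e' ∈ₗ edges T →
                   tgt e ≡ var v → tgt e' ≡ var v → e ≡ e'
    -- (4)
    distinct-times : ∀ C D t → con C t ∈ₗ nodes T → con D t ∈ₗ nodes T → C ≡ D
    total-order : ∃ λ (rank : Node n m → ℕ) →
      (∀ a b → a ∈ₗ nodes T → b ∈ₗ nodes T → rank a ≡ rank b → a ≡ b) ×
      (∀ C D s t → con C s ∈ₗ nodes T → con D t ∈ₗ nodes T → s < t →
         rank (con C s) < rank (con D t)) ×
      (∀ e → e ∈ₗ edges T → rank (src e) < rank (tgt e))
    -- (5)
    step-ok : ∀ u v C t → vc u C t ∈ₗ edges T → TouchesAt T v C t →
              rel I C (restrict I f C ⊕ u ⊕ v)
    -- (6) no shortcuts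
    no-shortcut : ∀ u v C s t → vc u C s ∈ₗ edges T → TouchesAt T v C t → s < t →
                  ¬ rel I C (restrict I f C ⊕ u ⊕ v)

touches : ∀ {n m} → List (Edge n m) → Fin n → Fin m → Bool
touches [] v C = false
touches (vc u D t ∷ es) v C = (⌊ u Fin.≟ v ⌋ ∧ ⌊ D Fin.≟ C ⌋) ∨ touches es v C
touches (cv D t u ∷ es) v C = (⌊ u Fin.≟ v ⌋ ∧ ⌊ D Fin.≟ C ⌋) ∨ touches es v C

_⊕T_ : ∀ {n m} → Labeling n m → DAG n m → Labeling n m
(f ⊕T T) v C = f v C xor touches (edges T) v C

-- Directed paths  x₀ C₁^{t₁} x₁ … C_k^{t_k} x_k, given by x₀ and the list
-- of steps (C_i , t_i , x_i).

Step : ℕ → ℕ → Set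
Step n m = Fin m × ℕ × Fin n

pathNodes : ∀ {n m} → Fin n → List (Step n m) → List (Node n m)
pathNodes x [] = var x ∷ []
pathNodes x ((C , t , y) ∷ ps) = var x ∷ con C t ∷ pathNodes y ps

pathEdges : ∀ {n m} → Fin n → List (Step n m) → List (Edge n m)
pathEdges x [] = []
pathEdges x ((C , t , y) ∷ ps) = vc x C t ∷ cv C t y ∷ pathEdges y ps

lastVar : ∀ {n m} → Fin n → List (Step n m) → Fin n
lastVar x [] = x
lastVar x ((C , t , y) ∷ ps) = lastVar y ps

-- (a): two paths x₀ C₁ x₁ … x_{k-1} C_k^{t_k} and y₀ D₁ … y_{ℓ-1} D_ℓ^{s_ℓ}
-- with common last node C^t = C_k^{t_k} = D_ℓ^{s_ℓ}.
twoPathDAG : ∀ {n m} → Fin n → List (Step n m) → Fin n → List (Step n m) →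
             Fin m → ℕ → DAG n m
twoPathDAG x ps y qs C t =
  dag (pathNodes x ps ++ pathNodes y qs ++ [ con C t ])
      (pathEdges x ps ++ [ vc (lastVar x ps) C t ] ++
       pathEdges y qs ++ [ vc (lastVar y qs) C t ])

onePathDAG : ∀ {n m} → Fin n → List (Step n m) → DAG n m
onePathDAG x ps = dag (pathNodes x ps) (pathEdges x ps)

-- Each visit of the paths to a constraint node C^t switches the two edges it uses at C.
-- Perform these switches in decreasing order of timestamps.  Switching the latest visit
-- keeps C satisfied by (5).  For an earlier visit of the same constraint, with entry u,
-- apply the exchange axiom of the even Δ-matroid to u: the exchange partner cannot be u
-- itself (parity), and cannot be a variable of the later visit, because that would be a
-- shortcut excluded by (6).  Hence the earlier visits again satisfy (5) and (6) with
-- respect to the new labeling, and induction on the timestamps finishes the proof.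

module Submission where

open import Defs
open import Algebra.Bundles using (CommutativeMonoid)
open import Data.Bool using (Bool; true; false; not; _∧_; _∨_; _xor_; T)
open import Data.Bool.ListAction using (any)
open import Data.Bool.Properties
  using (T-∨; ∨-assoc; ∨-identityʳ; ∨-commutativeMonoid; not-¬; xor-comm; xor-assoc; xor-same; xor-identityʳ)
open import Data.Empty using (⊥-elim)
open import Data.Fin using (Fin; zero; suc; _≟_)
open import Data.Fin.Subset using (Subset; _∈_)
open import Data.List using (List; []; _∷_; _++_; [_]; foldl; foldr; filter; map)
open import Data.List.Properties using (map-++)
open import Data.List.Membership.Propositional using (find; lose) renaming (_∈_ to _∈ₗ_; _∉_ to _∉ₗ_)
open import Data.List.Membership.Propositional.Properties
  using (∈-filter⁺; ∈-filter⁻; ∈-++⁺ˡ; ∈-++⁺ʳ; ∈-++⁻; ∈-map⁺)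
import Data.List.Membership.DecPropositional as DecMembership
open import Data.List.Relation.Binary.Sublist.Propositional using (_⊆_; []; _∷_; _∷ʳ_)
open import Data.List.Relation.Binary.Sublist.Propositional.Properties using (++⁺; []⊆-universal; All-resp-⊆)
import Data.List.Relation.Unary.All as All
open import Data.List.Relation.Unary.AllPairs using ([]; _∷_)
open import Data.List.Relation.Unary.Any using (here; there; any?)
open import Data.List.Relation.Unary.Any.Properties using (any⁺; any⁻)
open import Data.List.Relation.Unary.Unique.Propositional using (Unique)
open import Data.Nat using (ℕ; zero; suc; _%_; _<_; _≤_; _<?_; _⊔_) renaming (_≟_ to _≟ℕ_)
open import Data.Nat.DivMod using ([m+n]%n≡m%n)
open import Data.Nat.Properties
  using (+-comm; <-irrefl; ≤-pred; ≤∧≢⇒<; ≮⇒≥; ≤-antisym; ≤-trans; n≮0; m≤m⊔n; m≤n⊔m)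
open import Data.Product using (∃; _×_; _,_; proj₁; proj₂)
open import Data.Sum using (_⊎_; inj₁; inj₂)
open import Data.Vec using (Vec; _∷_; lookup)
open import Data.Vec.Properties
  using (lookup∘updateAt; lookup∘updateAt′; lookup∘tabulate; tabulate∘lookup; tabulate-cong; []=⇒lookup)
open import Function using (_∘_; id; Equivalence)
open import Relation.Binary.PropositionalEquality
  using (_≡_; _≢_; refl; sym; trans; cong; cong₂; subst; module ≡-Reasoning)
open import Relation.Nullary using (¬_; yes; no; Dec)
open import Relation.Nullary.Decidable using (⌊_⌋)

open import Algebra.Properties.CommutativeSemigroup
  (CommutativeMonoid.commutativeSemigroup ∨-commutativeMonoid) using (x∙yz≈y∙xz)

module _ {n : ℕ} where

  lookup-extensional : {α β : Vec Bool n} → (∀ i → lookup α i ≡ lookup β i) → α ≡ β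
  lookup-extensional {α} {β} α≗β =
    trans (sym (tabulate∘lookup α)) (trans (tabulate-cong α≗β) (tabulate∘lookup β))

  lookup-⊕ : ∀ (α : Vec Bool n) u i → lookup (α ⊕ u) i ≡ lookup α i xor ⌊ u ≟ i ⌋
  lookup-⊕ α u i with u ≟ i
  ... | yes refl = trans (lookup∘updateAt u α) (xor-comm true (lookup α u))
  ... | no u≢i   = trans (lookup∘updateAt′ i u (u≢i ∘ sym) α) (sym (xor-identityʳ _))

  lookup-⊕-⊕ : ∀ (α : Vec Bool n) u w i →
               lookup (α ⊕ u ⊕ w) i ≡ lookup α i xor (⌊ u ≟ i ⌋ xor ⌊ w ≟ i ⌋)
  lookup-⊕-⊕ α u w i = begin
    lookup (α ⊕ u ⊕ w) i                       ≡⟨ lookup-⊕ (α ⊕ u) w i ⟩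
    lookup (α ⊕ u) i xor ⌊ w ≟ i ⌋             ≡⟨ cong (_xor ⌊ w ≟ i ⌋) (lookup-⊕ α u i) ⟩
    (lookup α i xor ⌊ u ≟ i ⌋) xor ⌊ w ≟ i ⌋   ≡⟨ xor-assoc (lookup α i) _ _ ⟩
    lookup α i xor (⌊ u ≟ i ⌋ xor ⌊ w ≟ i ⌋)   ∎
    where open ≡-Reasoning

  ⊕-comm : ∀ (α : Vec Bool n) u w → α ⊕ u ⊕ w ≡ α ⊕ w ⊕ u
  ⊕-comm α u w = lookup-extensional λ i → begin
    lookup (α ⊕ u ⊕ w) i                      ≡⟨ lookup-⊕-⊕ α u w i ⟩
    lookup α i xor (⌊ u ≟ i ⌋ xor ⌊ w ≟ i ⌋)  ≡⟨ cong (lookup α i xor_) (xor-comm ⌊ u ≟ i ⌋ _) ⟩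
    lookup α i xor (⌊ w ≟ i ⌋ xor ⌊ u ≟ i ⌋)  ≡⟨ lookup-⊕-⊕ α w u i ⟨
    lookup (α ⊕ w ⊕ u) i                      ∎
    where open ≡-Reasoning

  ⊕-involutive : ∀ (α : Vec Bool n) u → α ⊕ u ⊕ u ≡ α
  ⊕-involutive α u = lookup-extensional λ i → begin
    lookup (α ⊕ u ⊕ u) i                      ≡⟨ lookup-⊕-⊕ α u u i ⟩
    lookup α i xor (⌊ u ≟ i ⌋ xor ⌊ u ≟ i ⌋)  ≡⟨ cong (lookup α i xor_) (xor-same ⌊ u ≟ i ⌋) ⟩
    lookup α i xor false                      ≡⟨ xor-identityʳ (lookup α i) ⟩
    lookup α i                                ∎
    where open ≡-Reasoning

  ⊕-unflip : ∀ (α : Vec Bool n) u w z → α ⊕ u ⊕ w ⊕ z ⊕ u ≡ α ⊕ z ⊕ w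
  ⊕-unflip α u w z = begin
    α ⊕ u ⊕ w ⊕ z ⊕ u   ≡⟨ ⊕-comm (α ⊕ u ⊕ w) z u ⟩
    α ⊕ u ⊕ w ⊕ u ⊕ z   ≡⟨ cong (_⊕ z) (⊕-comm (α ⊕ u) w u) ⟩
    α ⊕ u ⊕ u ⊕ w ⊕ z   ≡⟨ cong (λ β → β ⊕ w ⊕ z) (⊕-involutive α u) ⟩
    α ⊕ w ⊕ z           ≡⟨ ⊕-comm α w z ⟩
    α ⊕ z ⊕ w           ∎
    where open ≡-Reasoning

  _⊕*_ : Vec Bool n → List (Fin n) → Vec Bool n
  _⊕*_ = foldl _⊕_

  lookup-⊕*-∉ : ∀ (α : Vec Bool n) us {i} → i ∉ₗ us → lookup (α ⊕* us) i ≡ lookup α i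
  lookup-⊕*-∉ α []       i∉ = refl
  lookup-⊕*-∉ α (u ∷ us) i∉ =
    trans (lookup-⊕*-∉ (α ⊕ u) us (i∉ ∘ there)) (lookup∘updateAt′ _ u (i∉ ∘ here) α)

  open DecMembership (_≟_ {n}) using (_∈?_)

  differ⇒∈-flipped : ∀ (α : Vec Bool n) us vs {i} →
                     lookup (α ⊕* us) i ≢ lookup (α ⊕* vs) i → i ∈ₗ us ⊎ i ∈ₗ vs
  differ⇒∈-flipped α us vs {i} differ with i ∈? us | i ∈? vs
  ... | yes i∈us | _        = inj₁ i∈us
  ... | no _     | yes i∈vs = inj₂ i∈vs
  ... | no i∉us  | no i∉vs  =
    ⊥-elim (differ (trans (lookup-⊕*-∉ α us i∉us) (sym (lookup-⊕*-∉ α vs i∉vs))))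

ones-⊕ : ∀ {n} (α : Vec Bool n) u → ones (α ⊕ u) ≡ suc (ones α) ⊎ suc (ones (α ⊕ u)) ≡ ones α
ones-⊕ (true  ∷ α) zero    = inj₂ refl
ones-⊕ (false ∷ α) zero    = inj₁ refl
ones-⊕ (false ∷ α) (suc u) = ones-⊕ α u
ones-⊕ (true  ∷ α) (suc u) with ones-⊕ α u
... | inj₁ eq = inj₁ (cong suc eq)
... | inj₂ eq = inj₂ (cong suc eq)

suc-%2-≢ : ∀ k → suc k % 2 ≢ k % 2
suc-%2-≢ zero ()
suc-%2-≢ (suc zero) ()
suc-%2-≢ (suc (suc k)) eq = suc-%2-≢ k (trans (sym (+2-%2 (suc k))) (trans eq (+2-%2 k)))
  where
  +2-%2 : ∀ j → suc (suc j) % 2 ≡ j % 2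
  +2-%2 j = trans (cong (_% 2) (+-comm 2 j)) ([m+n]%n≡m%n j 2)

ones-⊕-parity : ∀ {n} (α : Vec Bool n) u → ones (α ⊕ u) % 2 ≢ ones α % 2
ones-⊕-parity α u eq with ones-⊕ α u
... | inj₁ more = suc-%2-≢ (ones α) (trans (cong (_% 2) (sym more)) eq)
... | inj₂ less = suc-%2-≢ (ones (α ⊕ u)) (trans (cong (_% 2) less) (sym eq))

-- Condition (6) for the entry u of an earlier visit and the variables a, b of a later
-- visit to the same constraint; u ∉ {a, b} comes from (2).
Blocked : ∀ {n} → (Vec Bool n → Set) → Vec Bool n → Fin n → Fin n → Fin n → Set
Blocked M α u a b = u ∉ₗ a ∷ b ∷ [] × ¬ M (α ⊕ u ⊕ a) × ¬ M (α ⊕ u ⊕ b)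

module EvenDeltaMatroid {n} {σ : Subset n} {M : Vec Bool n → Set}
                        (isEvenΔ : IsEvenDeltaMatroid σ M) where

  ¬M-⊕ : ∀ {α u} → M α → ¬ M (α ⊕ u)
  ¬M-⊕ {α} {u} Mα Mαu = ones-⊕-parity α u (proj₂ isEvenΔ (α ⊕ u) α Mαu Mα)

  exchange : ∀ {α β v} → M α → M β → v ∈ σ → lookup α v ≢ lookup β v →
             ∃ λ u → u ≢ v × lookup α u ≢ lookup β u × M (α ⊕ v ⊕ u)
  exchange {α} {β} {v} Mα Mβ v∈σ differ with proj₂ (proj₁ isEvenΔ) α β Mα Mβ v v∈σ differ
  ... | u , _ , differ-u , M-flip with v ≟ u
  ...   | yes refl = ⊥-elim (¬M-⊕ Mα M-flip)
  ...   | no v≢u   = u , v≢u ∘ sym , differ-u , M-flip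

  exchange-survives-flip : ∀ {α a b u w} → M (α ⊕ a ⊕ b) → M (α ⊕ u ⊕ w) → u ≢ w → u ∈ σ →
                           Blocked M α u a b → M (α ⊕ a ⊕ b ⊕ u ⊕ w)
  exchange-survives-flip {α} {a} {b} {u} {w} Mab Muw u≢w u∈σ (u∉ab , ¬Mua , ¬Mub) =
    conclude (exchange Mab Muw u∈σ differ-at-u)
    where
    differ-at-u : lookup (α ⊕ a ⊕ b) u ≢ lookup (α ⊕ u ⊕ w) u
    differ-at-u eq = not-¬ refl (begin
      lookup α u              ≡⟨ lookup-⊕*-∉ α (a ∷ b ∷ []) u∉ab ⟨
      lookup (α ⊕ a ⊕ b) u    ≡⟨ eq ⟩
      lookup (α ⊕ u ⊕ w) u    ≡⟨ lookup∘updateAt′ u w u≢w (α ⊕ u) ⟩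
      lookup (α ⊕ u) u        ≡⟨ lookup∘updateAt u α ⟩
      not (lookup α u)        ∎)
      where open ≡-Reasoning

    conclude : (∃ λ z → z ≢ u × lookup (α ⊕ a ⊕ b) z ≢ lookup (α ⊕ u ⊕ w) z × M (α ⊕ a ⊕ b ⊕ u ⊕ z)) →
               M (α ⊕ a ⊕ b ⊕ u ⊕ w)
    conclude (z , z≢u , differ-at-z , Mz) with differ⇒∈-flipped α (a ∷ b ∷ []) (u ∷ w ∷ []) differ-at-z
    ... | inj₁ (here refl)          = ⊥-elim (¬Mub (subst M (⊕-unflip α a b u) Mz))
    ... | inj₁ (there (here refl))  =
      ⊥-elim (¬Mua (subst M (⊕-unflip α b a u) (subst (λ β → M (β ⊕ u ⊕ b)) (⊕-comm α a b) Mz)))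
    ... | inj₂ (here refl)          = ⊥-elim (z≢u refl)
    ... | inj₂ (there (here refl))  = Mz

  ¬M-survives-flip : ∀ {α a b u x} → M α → u ∈ σ → Blocked M α u a b → u ≢ x →
                     ¬ M (α ⊕ u ⊕ x) → ¬ M (α ⊕ a ⊕ b ⊕ u ⊕ x)
  ¬M-survives-flip {α} {a} {b} {u} {x} Mα u∈σ (u∉ab , ¬Mua , ¬Mub) u≢x ¬Mux Mabux =
    refute (exchange Mα Mabux u∈σ differ-at-u)
    where
    differ-at-u : lookup α u ≢ lookup (α ⊕ a ⊕ b ⊕ u ⊕ x) u
    differ-at-u eq = not-¬ refl (begin
      lookup α u                      ≡⟨ eq ⟩
      lookup (α ⊕ a ⊕ b ⊕ u ⊕ x) u    ≡⟨ lookup∘updateAt′ u x u≢x (α ⊕ a ⊕ b ⊕ u) ⟩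
      lookup (α ⊕ a ⊕ b ⊕ u) u        ≡⟨ lookup∘updateAt u (α ⊕ a ⊕ b) ⟩
      not (lookup (α ⊕ a ⊕ b) u)      ≡⟨ cong not (lookup-⊕*-∉ α (a ∷ b ∷ []) u∉ab) ⟩
      not (lookup α u)                ∎)
      where open ≡-Reasoning

    refute : ¬ (∃ λ z → z ≢ u × lookup α z ≢ lookup (α ⊕ a ⊕ b ⊕ u ⊕ x) z × M (α ⊕ u ⊕ z))
    refute (z , z≢u , differ-at-z , Mz) with differ⇒∈-flipped α [] (a ∷ b ∷ u ∷ x ∷ []) differ-at-z
    ... | inj₂ (here refl)                         = ¬Mua Mz
    ... | inj₂ (there (here refl))                 = ¬Mub Mz
    ... | inj₂ (there (there (here refl)))         = z≢u refl
    ... | inj₂ (there (there (there (here refl)))) = ¬Mux Mz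

  blocked-survives-flip : ∀ {α a b u c d} → M α → u ∈ σ → Blocked M α u a b → Blocked M α u c d →
                          Blocked M (α ⊕ a ⊕ b) u c d
  blocked-survives-flip Mα u∈σ blocked-ab (u∉cd , ¬Muc , ¬Mud) =
    u∉cd ,
    ¬M-survives-flip Mα u∈σ blocked-ab (u∉cd ∘ λ { refl → here refl }) ¬Muc ,
    ¬M-survives-flip Mα u∈σ blocked-ab (u∉cd ∘ λ { refl → there (here refl) }) ¬Mud

¬T⇒≡false : ∀ {b} → ¬ T b → b ≡ false
¬T⇒≡false {true}  ¬Tb = ⊥-elim (¬Tb _)
¬T⇒≡false {false} ¬Tb = refl

T-injective : ∀ {x y} → (T x → T y) → (T y → T x) → x ≡ y
T-injective {true}  {true}  _   _   = refl
T-injective {true}  {false} x⇒y _   = ⊥-elim (x⇒y _)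
T-injective {false} {true}  _   y⇒x = ⊥-elim (y⇒x _)
T-injective {false} {false} _   _   = refl

xor-∨-disjoint : ∀ x {h o} → ¬ (T h × T o) → x xor (h ∨ o) ≡ (x xor h) xor o
xor-∨-disjoint x {true}  {true}  disjoint = ⊥-elim (disjoint _)
xor-∨-disjoint x {true}  {false} _        = sym (xor-identityʳ (x xor true))
xor-∨-disjoint x {false} {o}     _        = cong (_xor o) (sym (xor-identityʳ x))

-- A path passing through the constraint node constraint^time, arriving along the edge
-- {entry, constraint} and leaving along {exit, constraint}.
record Visit (n m : ℕ) : Set where
  constructor visit
  field
    constraint : Fin m
    time       : ℕ
    entry exit : Fin n

open Visit

module _ {n m : ℕ} where

  node : Visit n m → Node n m
  node p = con (constraint p) (time p)

  visitEdges : Visit n m → List (Edge n m)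
  visitEdges (visit C t a b) = vc a C t ∷ cv C t b ∷ []

  touchedBy : Visit n m → Fin n → Fin m → Bool
  touchedBy p = touches (visitEdges p)

  touchedByAny : List (Visit n m) → Fin n → Fin m → Bool
  touchedByAny Q v C = any (λ p → touchedBy p v C) Q

  _⊕v_ : Labeling n m → Visit n m → Labeling n m
  (g ⊕v p) v C = g v C xor touchedBy p v C

  _⊕vs_ : Labeling n m → List (Visit n m) → Labeling n m
  (g ⊕vs Q) v C = g v C xor touchedByAny Q v C

  touchedBy⇒ : ∀ p {v D} → T (touchedBy p v D) → constraint p ≡ D × v ∈ₗ entry p ∷ exit p ∷ []
  touchedBy⇒ (visit C t a b) {v} {D} touched with a ≟ v | b ≟ v | C ≟ D
  touchedBy⇒ _ _  | yes refl | _        | yes refl = refl , here refl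
  touchedBy⇒ _ _  | no _     | yes refl | yes refl = refl , there (here refl)
  touchedBy⇒ _ () | no _     | no _     | _
  touchedBy⇒ _ () | yes _    | yes _    | no _
  touchedBy⇒ _ () | yes _    | no _     | no _
  touchedBy⇒ _ () | no _     | yes _    | no _

  touchedBy-≢ : ∀ p {v D} → constraint p ≢ D → touchedBy p v D ≡ false
  touchedBy-≢ p C≢D = ¬T⇒≡false (C≢D ∘ proj₁ ∘ touchedBy⇒ p)

  timeBound : List (Visit n m) → ℕ
  timeBound = foldr (λ q B → suc (time q) ⊔ B) 0

  time<timeBound : ∀ {q Q} → q ∈ₗ Q → time q < timeBound Q
  time<timeBound {Q = p ∷ Q} (here refl)  = m≤m⊔n (suc (time p)) (timeBound Q)
  time<timeBound {Q = p ∷ Q} (there q∈Q) =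
    ≤-trans (time<timeBound q∈Q) (m≤n⊔m (suc (time p)) (timeBound Q))

  touches-++ : ∀ (es fs : List (Edge n m)) v C → touches (es ++ fs) v C ≡ touches es v C ∨ touches fs v C
  touches-++ []              fs v C = refl
  touches-++ (vc u D t ∷ es) fs v C = trans (cong (⌊ u ≟ v ⌋ ∧ ⌊ D ≟ C ⌋ ∨_) (touches-++ es fs v C))
                                            (sym (∨-assoc (⌊ u ≟ v ⌋ ∧ ⌊ D ≟ C ⌋) _ _))
  touches-++ (cv D t u ∷ es) fs v C = trans (cong (⌊ u ≟ v ⌋ ∧ ⌊ D ≟ C ⌋ ∨_) (touches-++ es fs v C))
                                            (sym (∨-assoc (⌊ u ≟ v ⌋ ∧ ⌊ D ≟ C ⌋) _ _))

  touchedByAny-++ : ∀ P Q v C → touchedByAny (P ++ Q) v C ≡ touchedByAny P v C ∨ touchedByAny Q v C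
  touchedByAny-++ []      Q v C = refl
  touchedByAny-++ (p ∷ P) Q v C =
    trans (cong (touchedBy p v C ∨_) (touchedByAny-++ P Q v C)) (sym (∨-assoc (touchedBy p v C) _ _))

  touchedByAny⇒ : ∀ Q {v D} → T (touchedByAny Q v D) → ∃ λ q → q ∈ₗ Q × T (touchedBy q v D)
  touchedByAny⇒ Q {v} {D} = find ∘ any⁻ (λ q → touchedBy q v D) Q

  ⇒touchedByAny : ∀ {Q q v D} → q ∈ₗ Q → T (touchedBy q v D) → T (touchedByAny Q v D)
  ⇒touchedByAny {v = v} {D} q∈Q = any⁺ (λ q → touchedBy q v D) ∘ lose q∈Q

module _ {n m} (I : Instance n m) where

  lookup-restrict : ∀ g C v → lookup (restrict I g C) v ≡ lookup (scope I C) v ∧ g v C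
  lookup-restrict g C v = lookup∘tabulate _ v

  restrict-⊕v-≢ : ∀ g C t a b {D} → C ≢ D → restrict I (g ⊕v visit C t a b) D ≡ restrict I g D
  restrict-⊕v-≢ g C t a b {D} C≢D = tabulate-cong λ v → cong (lookup (scope I D) v ∧_)
    (trans (cong (g v D xor_) (touchedBy-≢ (visit C t a b) C≢D)) (xor-identityʳ (g v D)))

  restrict-⊕v-≡ : ∀ g C t a b → a ≢ b → a ∈ scope I C → b ∈ scope I C →
                  restrict I (g ⊕v visit C t a b) C ≡ restrict I g C ⊕ a ⊕ b
  restrict-⊕v-≡ g C t a b a≢b a∈C b∈C = lookup-extensional pointwise
    where
    pointwise : ∀ v → lookup (restrict I (g ⊕v visit C t a b) C) v ≡ lookup (restrict I g C ⊕ a ⊕ b) v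
    pointwise v rewrite lookup-restrict (g ⊕v visit C t a b) C v | lookup-⊕-⊕ (restrict I g C) a b v
                      | lookup-restrict g C v with a ≟ v | b ≟ v | C ≟ C
    ... | _        | _        | no C≢C = ⊥-elim (C≢C refl)
    ... | yes refl | yes refl | yes _  = ⊥-elim (a≢b refl)
    ... | yes refl | no _     | yes _  rewrite []=⇒lookup a∈C = refl
    ... | no _     | yes refl | yes _  rewrite []=⇒lookup b∈C = refl
    ... | no _     | no _     | yes _  = trans (cong (lookup (scope I C) v ∧_) (xor-identityʳ (g v C)))
                                               (sym (xor-identityʳ _))

  Flippable : Labeling n m → Visit n m → Set
  Flippable g (visit C _ a b) =
    a ≢ b × a ∈ scope I C × b ∈ scope I C × rel I C (restrict I g C ⊕ a ⊕ b)

  NoShortcut : Labeling n m → Visit n m → Visit n m → Set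
  NoShortcut g (visit C _ a b) (visit _ _ a′ b′) =
    b′ ∉ₗ a ∷ b ∷ [] × Blocked (rel I C) (restrict I g C) a′ a b

  -- The consequences of the f-DAG axioms (2), (5), (6) for the visits Q, stated for an
  -- arbitrary labeling g so that they can be re-established after each switch.
  record Admissible (g : Labeling n m) (Q : List (Visit n m)) : Set where
    field
      flippable      : ∀ {p} → p ∈ₗ Q → Flippable g p
      time-injective : ∀ {p q} → p ∈ₗ Q → q ∈ₗ Q → time p ≡ time q → p ≡ q
      no-shortcut    : ∀ {C t a b t′ a′ b′} → visit C t a b ∈ₗ Q → visit C t′ a′ b′ ∈ₗ Q → t′ < t →
                       NoShortcut g (visit C t a b) (visit C t′ a′ b′)

  valid-resp : ∀ {g h} → (∀ v C → g v C ≡ h v C) → Valid I g → Valid I h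
  valid-resp {g} {h} g≗h valid C =
    subst (rel I C) (tabulate-cong λ v → cong (lookup (scope I C) v ∧_) (g≗h v C)) (valid C)

  restrict-⊕v-cases : ∀ (P : Fin m → Vec Bool n → Set) g C t a b → a ≢ b → a ∈ scope I C → b ∈ scope I C →
                      ∀ D → (C ≡ D → P C (restrict I g C ⊕ a ⊕ b)) → (C ≢ D → P D (restrict I g D)) →
                      P D (restrict I (g ⊕v visit C t a b) D)
  restrict-⊕v-cases P g C t a b a≢b a∈C b∈C D at-C elsewhere = by-cases (C ≟ D)
    where
    by-cases : Dec (C ≡ D) → P D (restrict I (g ⊕v visit C t a b) D)
    by-cases (yes refl) = subst (P C) (sym (restrict-⊕v-≡ g C t a b a≢b a∈C b∈C)) (at-C refl)
    by-cases (no C≢D)   = subst (P D) (sym (restrict-⊕v-≢ g C t a b C≢D)) (elsewhere C≢D)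

  valid-⊕v : ∀ {g p} → Valid I g → Flippable g p → Valid I (g ⊕v p)
  valid-⊕v {g} {visit C t a b} valid (a≢b , a∈C , b∈C , M-ab) D =
    restrict-⊕v-cases (rel I) g C t a b a≢b a∈C b∈C D (λ _ → M-ab) (λ _ → valid D)

  earlier : ℕ → List (Visit n m) → List (Visit n m)
  earlier t = filter (λ q → time q <? t)

  ∈-earlier⁻ : ∀ t Q {q} → q ∈ₗ earlier t Q → q ∈ₗ Q × time q < t
  ∈-earlier⁻ t Q = ∈-filter⁻ (λ q → time q <? t)

  ∈-earlier⁺ : ∀ {t q Q} → q ∈ₗ Q → time q < t → q ∈ₗ earlier t Q
  ∈-earlier⁺ {t} = ∈-filter⁺ (λ q → time q <? t)

  valid-⊕T : ∀ g T Q → (∀ v C → touches (edges T) v C ≡ touchedByAny Q v C) →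
             Valid I (g ⊕vs Q) → Valid I (g ⊕T T)
  valid-⊕T g T Q touches≡ = valid-resp (λ v C → cong (g v C xor_) (sym (touches≡ v C)))

  module _ {g Q C t a b} (adm : Admissible g Q) (p∈Q : visit C t a b ∈ₗ Q) where
    open Admissible adm

    touched-disjoint : ∀ v D → ¬ (T (touchedBy (visit C t a b) v D) × T (touchedByAny (earlier t Q) v D))
    touched-disjoint v D (touched-p , touched-earlier) with touchedByAny⇒ (earlier t Q) touched-earlier
    ... | visit D′ s u w , q∈ , touched-q
      with touchedBy⇒ (visit C t a b) touched-p | touchedBy⇒ (visit D′ s u w) touched-q | ∈-earlier⁻ t Q q∈
    ... | refl , v∈ab | refl , v∈uw | q∈Q , s<t with no-shortcut p∈Q q∈Q s<t | v∈uw
    ...   | _   , u∉ab , _ | here refl         = u∉ab v∈ab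
    ...   | w∉ab , _       | there (here refl) = w∉ab v∈ab

    touchedByAny-earlier : (∀ {q} → q ∈ₗ Q → time q ≤ t) → ∀ v D →
      touchedByAny Q v D ≡ touchedBy (visit C t a b) v D ∨ touchedByAny (earlier t Q) v D
    touchedByAny-earlier t-max v D = T-injective split merge
      where
      split : T (touchedByAny Q v D) → T (touchedBy (visit C t a b) v D ∨ touchedByAny (earlier t Q) v D)
      split touched with touchedByAny⇒ Q touched
      ... | q , q∈Q , touched-q with time q <? t
      ...   | yes q<t = Equivalence.from T-∨ (inj₂ (⇒touchedByAny (∈-earlier⁺ q∈Q q<t) touched-q))
      ...   | no q≮t with time-injective q∈Q p∈Q (≤-antisym (t-max q∈Q) (≮⇒≥ q≮t))
      ...     | refl = Equivalence.from T-∨ (inj₁ touched-q)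

      merge : T (touchedBy (visit C t a b) v D ∨ touchedByAny (earlier t Q) v D) → T (touchedByAny Q v D)
      merge touched with Equivalence.to T-∨ touched
      ... | inj₁ touched-p = ⇒touchedByAny p∈Q touched-p
      ... | inj₂ touched-earlier with touchedByAny⇒ (earlier t Q) touched-earlier
      ...   | q , q∈ , touched-q = ⇒touchedByAny (proj₁ (∈-earlier⁻ t Q q∈)) touched-q

    ⊕vs-earlier : (∀ {q} → q ∈ₗ Q → time q ≤ t) → ∀ v D →
                  (g ⊕vs Q) v D ≡ ((g ⊕v visit C t a b) ⊕vs earlier t Q) v D
    ⊕vs-earlier t-max v D =
      trans (cong (g v D xor_) (touchedByAny-earlier t-max v D))
            (xor-∨-disjoint (g v D) (touched-disjoint v D))

  module _ (isEvenΔ : ∀ C → IsEvenDeltaMatroid (scope I C) (rel I C)) where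

    admissible-⊕v : ∀ {g Q C t a b} → Valid I g → Admissible g Q → visit C t a b ∈ₗ Q →
                    Admissible (g ⊕v visit C t a b) (earlier t Q)
    admissible-⊕v {g} {Q} {C} {t} {a} {b} valid adm p∈Q = record
      { flippable      = flippable′ ∘ ∈-earlier⁻ t Q
      ; time-injective = λ p∈ q∈ → time-injective (proj₁ (∈-earlier⁻ t Q p∈)) (proj₁ (∈-earlier⁻ t Q q∈))
      ; no-shortcut    = λ q₁∈ q₂∈ → no-shortcut′ (∈-earlier⁻ t Q q₁∈) (∈-earlier⁻ t Q q₂∈)
      }
      where
      open Admissible adm
      open EvenDeltaMatroid (isEvenΔ C)

      flip-p : ∀ (P : Fin m → Vec Bool n → Set) D → (C ≡ D → P C (restrict I g C ⊕ a ⊕ b)) →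
               (C ≢ D → P D (restrict I g D)) → P D (restrict I (g ⊕v visit C t a b) D)
      flip-p P with flippable p∈Q
      ... | a≢b , a∈C , b∈C , _ = restrict-⊕v-cases P g C t a b a≢b a∈C b∈C

      flippable′ : ∀ {q} → q ∈ₗ Q × time q < t → Flippable (g ⊕v visit C t a b) q
      flippable′ {visit D s u w} (q∈Q , s<t) with flippable q∈Q
      ... | u≢w , u∈D , w∈D , M-uw = u≢w , u∈D , w∈D ,
        flip-p (λ D′ α → rel I D′ (α ⊕ u ⊕ w)) D
          (λ { refl → exchange-survives-flip (proj₂ (proj₂ (proj₂ (flippable p∈Q)))) M-uw u≢w u∈D
                        (proj₂ (no-shortcut p∈Q q∈Q s<t)) })
          (λ _ → M-uw)

      no-shortcut′ : ∀ {D s a₁ b₁ s′ a₂ b₂} →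
                     visit D s a₁ b₁ ∈ₗ Q × s < t → visit D s′ a₂ b₂ ∈ₗ Q × s′ < t → s′ < s → NoShortcut (g ⊕v visit C t a b) (visit D s a₁ b₁) (visit D s′ a₂ b₂)
      no-shortcut′ {D} {a₁ = a₁} {b₁ = b₁} {a₂ = a₂} (q₁∈Q , _) (q₂∈Q , s′<t) s′<s
        with no-shortcut q₁∈Q q₂∈Q s′<s
      ... | b₂∉ , blocked = b₂∉ ,
        flip-p (λ D′ α → Blocked (rel I D′) α a₂ a₁ b₁) D
          (λ { refl → blocked-survives-flip (valid C) (proj₁ (proj₂ (flippable q₂∈Q)))
                        (proj₂ (no-shortcut p∈Q q₂∈Q s′<t)) blocked })
          (λ _ → blocked)

    valid-⊕vs-below : ∀ B {g Q} →
                      (∀ {q} → q ∈ₗ Q → time q < B) → Admissible g Q → Valid I g → Valid I (g ⊕vs Q)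
    valid-⊕vs-below zero {Q = []} _ _ valid = valid-resp (λ v C → sym (xor-identityʳ _)) valid
    valid-⊕vs-below zero {Q = _ ∷ _} below = ⊥-elim (n≮0 (below (here refl)))
    valid-⊕vs-below (suc B) {g} {Q} below adm valid with any? (λ q → time q ≟ℕ B) Q
    ... | no none = valid-⊕vs-below B (λ q∈ → ≤∧≢⇒< (≤-pred (below q∈)) (none ∘ lose q∈)) adm valid
    ... | yes some with find some
    ...   | visit C t a b , p∈Q , refl =
      valid-resp (λ v D → sym (⊕vs-earlier adm p∈Q t-max v D))
        (valid-⊕vs-below t (proj₂ ∘ ∈-earlier⁻ t Q)
          (admissible-⊕v valid adm p∈Q)
          (valid-⊕v {p = visit C t a b} valid (Admissible.flippable adm p∈Q)))
      where
      t-max : ∀ {q} → q ∈ₗ Q → time q ≤ t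
      t-max = ≤-pred ∘ below

    valid-⊕vs : ∀ {g Q} → Admissible g Q → Valid I g → Valid I (g ⊕vs Q)
    valid-⊕vs = valid-⊕vs-below _ time<timeBound

unique-map-injective : ∀ {A B : Set} (f : A → B) {xs x y} → Unique (map f xs) →
                       x ∈ₗ xs → y ∈ₗ xs → f x ≡ f y → x ≡ y
unique-map-injective f _            (here refl)  (here refl)  _     = refl
unique-map-injective f (fx∉ ∷ _)    (here refl)  (there y∈xs) fx≡fy =
  ⊥-elim (All.lookup fx∉ (∈-map⁺ f y∈xs) fx≡fy)
unique-map-injective f (fy∉ ∷ _)    (there x∈xs) (here refl)  fx≡fy =
  ⊥-elim (All.lookup fy∉ (∈-map⁺ f x∈xs) (sym fx≡fy))
unique-map-injective f (_ ∷ unique) (there x∈xs) (there y∈xs) fx≡fy =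
  unique-map-injective f unique x∈xs y∈xs fx≡fy

Unique-resp-⊆ : ∀ {A : Set} {xs ys : List A} → xs ⊆ ys → Unique ys → Unique xs
Unique-resp-⊆ []             []               = []
Unique-resp-⊆ (y ∷ʳ xs⊆ys)   (_ ∷ unique)     = Unique-resp-⊆ xs⊆ys unique
Unique-resp-⊆ (refl ∷ xs⊆ys) (y∉ys ∷ unique)  = All-resp-⊆ xs⊆ys y∉ys ∷ Unique-resp-⊆ xs⊆ys unique

module _ {n m : ℕ} where

  pathVisits : Fin n → List (Step n m) → List (Visit n m)
  pathVisits x []                = []
  pathVisits x ((C , t , y) ∷ ps) = visit C t x y ∷ pathVisits y ps

  ∈-pathEdges : ∀ x ps {C t a b} → visit C t a b ∈ₗ pathVisits x ps →
                vc a C t ∈ₗ pathEdges x ps × cv C t b ∈ₗ pathEdges x ps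
  ∈-pathEdges x ((C , t , y) ∷ ps) (here refl) = here refl , there (here refl)
  ∈-pathEdges x ((C , t , y) ∷ ps) (there p∈) with ∈-pathEdges y ps p∈
  ... | a→C , C→b = there (there a→C) , there (there C→b)

  touches-pathEdges : ∀ x ps v D → touches (pathEdges x ps) v D ≡ touchedByAny (pathVisits x ps) v D
  touches-pathEdges x []                v D = refl
  touches-pathEdges x ((C , t , y) ∷ ps) v D =
    trans (touches-++ (visitEdges (visit C t x y)) (pathEdges y ps) v D)
          (cong (touchedBy (visit C t x y) v D ∨_) (touches-pathEdges y ps v D))

  pathVisits-⊆ : ∀ x ps → map node (pathVisits x ps) ⊆ pathNodes x ps
  pathVisits-⊆ x []                = var x ∷ʳ []
  pathVisits-⊆ x ((C , t , y) ∷ ps) = var x ∷ʳ (refl ∷ pathVisits-⊆ y ps)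

  lastVar-⊆ : ∀ x ps → [ var (lastVar x ps) ] ⊆ pathNodes {n} {m} x ps
  lastVar-⊆ x []                = refl ∷ []
  lastVar-⊆ x ((C , t , y) ∷ ps) = var x ∷ʳ (con C t ∷ʳ lastVar-⊆ y ps)

  twoPathVisits : Fin n → List (Step n m) → Fin n → List (Step n m) → Fin m → ℕ → List (Visit n m)
  twoPathVisits x ps y qs C t =
    pathVisits x ps ++ pathVisits y qs ++ [ visit C t (lastVar x ps) (lastVar y qs) ]

  -- The common last node is recorded as a visit entered from the first path and left
  -- towards the second; this is harmless since touches ignores edge directions.
  touches-twoPath : ∀ x ps y qs C t v D →
    touches (edges (twoPathDAG x ps y qs C t)) v D ≡ touchedByAny (twoPathVisits x ps y qs C t) v D
  touches-twoPath x ps y qs C t v D = begin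
    touches (PEx ++ vc lx C t ∷ PEy ++ [ vc ly C t ]) v D
      ≡⟨ touches-++ PEx _ v D ⟩
    tx ∨ (ex ∨ touches (PEy ++ [ vc ly C t ]) v D)
      ≡⟨ cong (λ z → tx ∨ (ex ∨ z)) (touches-++ PEy _ v D) ⟩
    tx ∨ (ex ∨ (ty ∨ ey))
      ≡⟨ cong (tx ∨_) (x∙yz≈y∙xz ex ty ey) ⟩
    tx ∨ (ty ∨ touchedBy final v D)
      ≡⟨ cong₂ (λ z w → z ∨ (w ∨ touchedBy final v D)) (touches-pathEdges x ps v D) (touches-pathEdges y qs v D) ⟩
    Tx ∨ (Ty ∨ touchedBy final v D)
      ≡⟨ cong (λ z → Tx ∨ (Ty ∨ z)) (∨-identityʳ _) ⟨
    Tx ∨ (Ty ∨ touchedByAny [ final ] v D)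
      ≡⟨ cong (Tx ∨_) (touchedByAny-++ Py _ v D) ⟨
    Tx ∨ touchedByAny (Py ++ [ final ]) v D
      ≡⟨ touchedByAny-++ Px _ v D ⟨
    touchedByAny (twoPathVisits x ps y qs C t) v D
      ∎
    where
    open ≡-Reasoning
    lx = lastVar x ps
    ly = lastVar y qs
    final = visit C t lx ly
    PEx = pathEdges x ps
    PEy = pathEdges y qs
    Px = pathVisits x ps
    Py = pathVisits y qs
    tx = touches PEx v D
    ty = touches PEy v D
    Tx = touchedByAny Px v D
    Ty = touchedByAny Py v D
    ex = ⌊ lx ≟ v ⌋ ∧ ⌊ C ≟ D ⌋
    ey = touches [ vc ly C t ] v D

Realized : ∀ {n m} → DAG n m → Visit n m → Set
Realized T (visit C t a b) = vc a C t ∈ₗ edges T × TouchesAt T b C t × a ≢ b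

module _ {n m} (I : Instance n m) {f : Labeling n m} {T : DAG n m} (fdag : IsFDAG I f T) where
  open IsFDAG fdag

  touching-in-scope : ∀ {v C t} → TouchesAt T v C t → v ∈ scope I C
  touching-in-scope (inj₁ v→C) = edge-vc _ _ _ v→C
  touching-in-scope (inj₂ C→v) = edge-cv _ _ _ C→v

  admissible-fDAG : ∀ {Q} → (∀ {p} → p ∈ₗ Q → Realized T p) → Unique (map node Q) → Admissible I f Q
  admissible-fDAG {Q} realized unique = record
    { flippable = flippable′ ; time-injective = time-injective′ ; no-shortcut = no-shortcut′ }
    where
    flippable′ : ∀ {p} → p ∈ₗ Q → Flippable I f p
    flippable′ {visit C t a b} p∈Q with realized p∈Q
    ... | a→C , touches-b , a≢b =
      a≢b , edge-vc a C t a→C , touching-in-scope touches-b , step-ok a b C t a→C touches-b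

    time-injective′ : ∀ {p q} → p ∈ₗ Q → q ∈ₗ Q → time p ≡ time q → p ≡ q
    time-injective′ {visit C t a b} {visit C′ _ a′ b′} p∈Q q∈Q refl with realized p∈Q | realized q∈Q
    ... | a→C , _ | a′→C′ , _
      with distinct-times C C′ t (proj₂ (edge-ends _ a→C)) (proj₂ (edge-ends _ a′→C′))
    ...   | refl = unique-map-injective node unique p∈Q q∈Q refl

    no-shortcut′ : ∀ {C t a b t′ a′ b′} → visit C t a b ∈ₗ Q → visit C t′ a′ b′ ∈ₗ Q → t′ < t →
                   NoShortcut I f (visit C t a b) (visit C t′ a′ b′)
    no-shortcut′ {C} {t} {a} {b} {t′} {a′} {b′} p∈Q q∈Q t′<t with realized p∈Q | realized q∈Q
    ... | a→C , touches-b , _ | a′→C , touches-b′ , _ =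
      not-later touches-b′ , not-later (inj₁ a′→C) ,
      no-shortcut a′ a C t′ t a′→C (inj₁ a→C) t′<t , no-shortcut a′ b C t′ t a′→C touches-b t′<t
      where
      not-later : ∀ {v} → TouchesAt T v C t′ → v ∉ₗ a ∷ b ∷ []
      not-later touches-v (here refl)         = <-irrefl (one-time _ C t′ t touches-v (inj₁ a→C)) t′<t
      not-later touches-v (there (here refl)) = <-irrefl (one-time _ C t′ t touches-v touches-b) t′<t

  pathVisits-realized : ∀ x ps → (∀ {e} → e ∈ₗ pathEdges x ps → e ∈ₗ edges T) →
                        ∀ {p} → p ∈ₗ pathVisits x ps → Realized T p
  pathVisits-realized x ps ⊆edges {visit C t a b} p∈ with ∈-pathEdges x ps p∈
  ... | a→C , C→b = ⊆edges a→C , inj₂ (⊆edges C→b) , λ { refl → not-both a C t (⊆edges a→C) (⊆edges C→b) }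

module _ {n m} (I : Instance n m) (isEvenΔ : ∀ C → IsEvenDeltaMatroid (scope I C) (rel I C))
         {f : Labeling n m} (valid : Valid I f) where

  onePath-valid : ∀ x ps → Unique (nodes (onePathDAG x ps)) → IsFDAG I f (onePathDAG x ps) →
                  Valid I (f ⊕T onePathDAG x ps)
  onePath-valid x ps unique fdag =
    valid-⊕T I f (onePathDAG x ps) (pathVisits x ps) (touches-pathEdges x ps)
      (valid-⊕vs I isEvenΔ admissible valid)
    where
    admissible : Admissible I f (pathVisits x ps)
    admissible = admissible-fDAG I fdag (pathVisits-realized I fdag x ps id)
                   (Unique-resp-⊆ (pathVisits-⊆ x ps) unique)

  twoPath-valid : ∀ x ps y qs C t → Unique (nodes (twoPathDAG x ps y qs C t)) →
                  IsFDAG I f (twoPathDAG x ps y qs C t) → Valid I (f ⊕T twoPathDAG x ps y qs C t)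
  twoPath-valid x ps y qs C t unique fdag =
    valid-⊕T I f (twoPathDAG x ps y qs C t) Q (touches-twoPath x ps y qs C t)
      (valid-⊕vs I isEvenΔ admissible valid)
    where
    Px = pathVisits x ps
    Py = pathVisits y qs
    PEx = pathEdges x ps
    PEy = pathEdges y qs
    final = visit C t (lastVar x ps) (lastVar y qs)
    Q = Px ++ Py ++ [ final ]

    lastVars-distinct : lastVar x ps ≢ lastVar y qs
    lastVars-distinct
      with Unique-resp-⊆ (++⁺ (lastVar-⊆ x ps) (++⁺ (lastVar-⊆ y qs) ([]⊆-universal _))) unique
    ... | lx∉rest ∷ _ = All.head lx∉rest ∘ cong var

    realized : ∀ {p} → p ∈ₗ Q → Realized (twoPathDAG x ps y qs C t) p
    realized p∈Q with ∈-++⁻ Px p∈Q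
    ... | inj₁ p∈Px = pathVisits-realized I fdag x ps ∈-++⁺ˡ p∈Px
    ... | inj₂ p∈rest with ∈-++⁻ Py p∈rest
    ...   | inj₁ p∈Py = pathVisits-realized I fdag y qs (∈-++⁺ʳ PEx ∘ there ∘ ∈-++⁺ˡ) p∈Py
    ...   | inj₂ (here refl) =
      ∈-++⁺ʳ PEx (here refl) , inj₁ (∈-++⁺ʳ PEx (there (∈-++⁺ʳ PEy (here refl)))) , lastVars-distinct

    nodes-⊆ : map node Q ⊆ nodes (twoPathDAG x ps y qs C t)
    nodes-⊆ rewrite map-++ node Px (Py ++ [ final ]) | map-++ node Py [ final ] =
      ++⁺ (pathVisits-⊆ x ps) (++⁺ (pathVisits-⊆ y qs) (refl ∷ []))

    admissible : Admissible I f Q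
    admissible = admissible-fDAG I fdag realized (Unique-resp-⊆ nodes-⊆ unique)

mainTheorem18 : ∀ {n m} (I : Instance n m) →
    (∀ C → IsEvenDeltaMatroid (scope I C) (rel I C)) →
    (f : Labeling n m) → Valid I f →
    (∀ (x₀ : Fin n) (ps : List (Step n m)) (y₀ : Fin n) (qs : List (Step n m))
       (C : Fin m) (t : ℕ) →
       Unique (nodes (twoPathDAG x₀ ps y₀ qs C t)) →
       IsFDAG I f (twoPathDAG x₀ ps y₀ qs C t) →
       Valid I (f ⊕T twoPathDAG x₀ ps y₀ qs C t))
    ×
    (∀ (x₀ : Fin n) (ps : List (Step n m)) →
       Unique (nodes (onePathDAG x₀ ps)) →
       IsFDAG I f (onePathDAG x₀ ps) →
       Valid I (f ⊕T onePathDAG x₀ ps))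
mainTheorem18 I isEvenΔ f valid = twoPath-valid I isEvenΔ valid , onePath-valid I isEvenΔ valid
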